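{- Let $G$ be a ($P_5$, bull, diamond)-free graph. Then $\chi(G)\le\max\{3,\omega(G)\}$.
   Context: Graphs are finite, simple, undirected. $P_5$ is the path on 5 vertices. A bull is a triangle with two pendant edges attached at two different vertices of the triangle; a diamond is $K_4$ minus one edge. $\mathcal{F}$-free means no induced subgraph isomorphic to a member of $\mathcal{F}$. $\chi$ is chromatic number, $\omega$ clique number. -}

module Defs where

open import Data.Nat using (ℕ; _⊔_)
open import Data.Fin using (Fin; zero; suc; _≟_)
open import Data.Bool using (Bool; true; false; _∨_; _∧_; if_then_else_)
open import Data.Bool.Properties using (∨-comm; ∧-comm)
open import Data.List using (List; []; _∷_)
open import Data.Bool.ListAction using (any)
open import Data.Product using (Σ; _×_; _,_)
open import Relation.Binary.PropositionalEquality using (_≡_; refl; cong; sym; trans)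
open import Relation.Nullary using (¬_; yes; no; does)
open import Function.Definitions using (Injective)

record Graph (n : ℕ) : Set where
  field
    adj    : Fin n → Fin n → Bool
    adj-sym : ∀ i j → adj i j ≡ adj j i
    adj-irrefl : ∀ i → adj i i ≡ false
open Graph public

_≲_ : ∀ {k n} → Graph k → Graph n → Set
_≲_ {k} {n} H G = Σ (Fin k → Fin n) λ f →
  Injective _≡_ _≡_ f × (∀ i j → adj G (f i) (f j) ≡ adj H i j)

_Free_ : ∀ {k n} → Graph n → Graph k → Set
G Free H = ¬ (H ≲ G)

private
  eqb : ∀ {k} → Fin k → Fin k → Bool
  eqb i j = does (i ≟ j)

  hit : ∀ {k} → Fin k → Fin k → Fin k × Fin k → Bool
  hit i j (a , b) = (eqb i a ∧ eqb j b) ∨ (eqb i b ∧ eqb j a)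

  hit-sym : ∀ {k} (i j : Fin k) e → hit i j e ≡ hit j i e
  hit-sym i j (a , b) rewrite ∨-comm (eqb i a ∧ eqb j b) (eqb i b ∧ eqb j a)
    | ∧-comm (eqb i b) (eqb j a) | ∧-comm (eqb i a) (eqb j b) = refl

  anyl-sym : ∀ {k} (i j : Fin k) es →
    any (hit i j) es ≡ any (hit j i) es
  anyl-sym i j [] = refl
  anyl-sym i j (e ∷ es) rewrite hit-sym i j e | anyl-sym i j es = refl

  eqb-sym : ∀ {k} (i j : Fin k) → eqb i j ≡ eqb j i
  eqb-sym i j with i ≟ j | j ≟ i
  ... | yes _ | yes _ = refl
  ... | no _  | no _  = refl
  ... | yes p | no q  = Data.Empty.⊥-elim (q (sym p)) where import Data.Empty
  ... | no p  | yes q = Data.Empty.⊥-elim (p (sym q)) where import Data.Empty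

  eqb-refl : ∀ {k} (i : Fin k) → eqb i i ≡ true
  eqb-refl i with i ≟ i
  ... | yes _ = refl
  ... | no p  = Data.Empty.⊥-elim (p refl) where import Data.Empty

  fadj : ∀ {k} → List (Fin k × Fin k) → Fin k → Fin k → Bool
  fadj es i j = if eqb i j then false else any (hit i j) es

fromEdges : ∀ {k} → List (Fin k × Fin k) → Graph k
fromEdges es = record { adj = fadj es ; adj-sym = s ; adj-irrefl = r }
  where
  s : ∀ i j → fadj es i j ≡ fadj es j i
  s i j rewrite eqb-sym i j | anyl-sym i j es = refl
  r : ∀ i → fadj es i i ≡ false
  r i rewrite eqb-refl i = refl

v0 v1 v2 v3 v4 : ∀ {k} → Fin (5 Data.Nat.+ k)
v0 = zero
v1 = suc zero
v2 = suc (suc zero)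
v3 = suc (suc (suc zero))
v4 = suc (suc (suc (suc zero)))

P5 : Graph 5
P5 = fromEdges ((v0 , v1) ∷ (v1 , v2) ∷ (v2 , v3) ∷ (v3 , v4) ∷ [])

Bull : Graph 5
Bull = fromEdges ((v0 , v1) ∷ (v1 , v2) ∷ (v0 , v2) ∷ (v0 , v3) ∷ (v1 , v4) ∷ [])

Diamond : Graph 4
Diamond = fromEdges ((zero , suc zero) ∷ (zero , suc (suc zero)) ∷ (zero , suc (suc (suc zero)))
                   ∷ (suc zero , suc (suc zero)) ∷ (suc zero , suc (suc (suc zero))) ∷ [])

IsClique : ∀ {n k} → Graph n → (Fin k → Fin n) → Set
IsClique G f = Injective _≡_ _≡_ f × (∀ i j → ¬ i ≡ j → adj G (f i) (f j) ≡ true)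

HasClique : ∀ {n} → Graph n → ℕ → Set
HasClique {n} G k = Σ (Fin k → Fin n) (IsClique G)

-- ω(G) = w : G has a clique of size w and no clique of size w + 1
-- (equivalently none larger, since cliques restrict).
IsCliqueNumber : ∀ {n} → Graph n → ℕ → Set
IsCliqueNumber G w = HasClique G w × ¬ HasClique G (Data.Nat.suc w)

Colouring : ∀ {n} → Graph n → ℕ → Set
Colouring {n} G c = Σ (Fin n → Fin c) λ col →
  ∀ i j → adj G i j ≡ true → ¬ col i ≡ col j

χ≤ : ∀ {n} → Graph n → ℕ → Set
χ≤ G c = Colouring G c

module Submission where

open import Defs
open import Function using (_∘_; id; case_of_)
open import Data.Nat using (ℕ; zero; suc; _≤_; _<_; _<?_; _⊔_; z≤n; s≤s)
open import Data.Nat.Properties using (≤-refl; ≤-reflexive; ≤-trans; <-irrefl; n≤1+n; m≤n⇒m≤1+n; 1+n≢n; ≮⇒≥; m≤m⊔n; m≤n⊔m; module ≤-Reasoning)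
open import Data.Nat.Induction using (<-rec)
open import Data.Bool using (Bool; true; false; _∨_; _∧_; not; if_then_else_)
import Data.Bool.Properties as Bool
open import Data.Fin using (Fin; zero; suc; toℕ; inject₁; inject≤; fromℕ<) renaming (_≟_ to _≟ᶠ_; _<_ to _<ᶠ_)
open import Data.Fin.Properties using (any?; all?; <-cmp; suc-injective; inject≤-injective; injective⇒≤; toℕ-inject₁)
open import Data.Fin.Relation.Unary.Top using (view; ‵fromℕ; ‵inject₁)
open import Data.List using (List; []; _∷_; map; _++_; allFin)
open import Data.List.Membership.Propositional using (_∈_)
open import Data.List.Membership.Propositional.Properties using (∈-map⁺; ∈-++⁺ˡ; ∈-++⁺ʳ; ∈-allFin)
open import Data.List.Relation.Unary.All as All using (All; []; _∷_)
open import Data.Vec using (Vec; lookup; []; _∷_)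
import Data.Product as Product
open import Data.Product using (Σ; ∃; ∃₂; _×_; _,_; proj₁; proj₂; uncurry)
open import Data.Sum using (_⊎_; inj₁; inj₂)
open import Data.Empty using (⊥; ⊥-elim)
open import Relation.Binary using (tri<; tri≈; tri>)
open import Relation.Binary.PropositionalEquality using (_≡_; _≢_; refl; sym; trans; cong; ≢-sym)
open import Relation.Nullary using (¬_; Dec; yes; no; does)
open import Relation.Nullary.Decidable using (toWitness; dec-true; dec-false; ¬?; _×-dec_; _⊎-dec_; _→-dec_)

-- Induction on the number of vertices, with k = max(3, ω) colours. A vertex x of
-- degree < k, or one whose neighbourhood lies inside that of a non-neighbour u, is
-- deleted; after colouring the rest, x gets a free colour, resp. the colour of u.
-- Otherwise every degree is ≥ k and no vertex is dominated. Diamond-freeness makes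
-- each neighbourhood N(a) a disjoint union of cliques. There is no induced C5 (a
-- third neighbour of one of its vertices would be a dominating clone of a cycle
-- neighbour), so N(a) has neither two isolated vertices (they would close a P5 or
-- C5) nor two non-trivial components (N[x] would be a clique of size > k); as N(a)
-- is not a clique it is a clique plus one vertex partner(a) isolated in N(a). For
-- any v, K = {v} ∪ N(v) − partner(v) is then a clique in which every a has
-- partner(a) as its only neighbour outside K, and distinct members have adjacent
-- partners. Colour G − K and give each a ∈ K the successor of its partner's colour.

-- Vertex sets as Boolean predicates, and their sizes

_⊆_ : ∀ {n} → (Fin n → Bool) → (Fin n → Bool) → Set
P ⊆ Q = ∀ i → P i ≡ true → Q i ≡ true

insert : ∀ {n} → Fin n → (Fin n → Bool) → Fin n → Bool
insert x P i = does (i ≟ᶠ x) ∨ P i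

remove : ∀ {n} → Fin n → (Fin n → Bool) → Fin n → Bool
remove x P i = P i ∧ not (does (i ≟ᶠ x))

module _ {n} {P : Fin n → Bool} where

  insert-∈ : ∀ x → insert x P x ≡ true
  insert-∈ x rewrite dec-true (x ≟ᶠ x) refl = refl

  insert-cases : ∀ {x i} → insert x P i ≡ true → i ≡ x ⊎ P i ≡ true
  insert-cases {x} {i} h with i ≟ᶠ x
  ... | yes i≡x = inj₁ i≡x
  ... | no _ = inj₂ h

  remove⁺ : ∀ {x i} → P i ≡ true → i ≢ x → remove x P i ≡ true
  remove⁺ {x} {i} Pi i≢x rewrite Pi | dec-false (i ≟ᶠ x) i≢x = refl

  ⊆-insert-remove : ∀ {x} → P ⊆ insert x (remove x P)
  ⊆-insert-remove {x} i Pi with i ≟ᶠ x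
  ... | yes _ = refl
  ... | no _ rewrite Pi = refl

  remove-∉ : ∀ {x i} → P i ≡ false → remove x P i ≡ false
  remove-∉ Pi rewrite Pi = refl

  remove⁻ : ∀ {x i} → remove x P i ≡ true → P i ≡ true × i ≢ x
  remove⁻ {x} {i} h with P i | i ≟ᶠ x
  ... | true | no i≢x = refl , i≢x

∈∉⇒≢ : ∀ {n} {P : Fin n → Bool} {x y} → P x ≡ true → P y ≡ false → x ≢ y
∈∉⇒≢ Px Py refl with () ← trans (sym Px) Py

⊈-witness : ∀ {n} {P Q : Fin n → Bool} → ¬ P ⊆ Q → ∃ λ w → P w ≡ true × Q w ≡ false
⊈-witness {P = P} {Q} P⊈Q with any? (λ w → (P w Bool.≟ true) ×-dec (Q w Bool.≟ false))
... | yes found = found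
... | no none = ⊥-elim (P⊈Q P⊆Q)
  where
  P⊆Q : P ⊆ Q
  P⊆Q w Pw with Q w in Qw
  ... | true = refl
  ... | false = ⊥-elim (none (w , Pw , Qw))

disjoint-or-meet : ∀ {n} (P Q : Fin n → Bool) → (∀ w → P w ≡ true → Q w ≡ false) ⊎ ∃ λ w → P w ≡ true × Q w ≡ true
disjoint-or-meet P Q with any? (λ w → (P w Bool.≟ true) ×-dec (Q w Bool.≟ true))
... | yes meet = inj₂ meet
... | no none = inj₁ disjoint
  where
  disjoint : ∀ w → P w ≡ true → Q w ≡ false
  disjoint w Pw with Q w in Qw
  ... | false = refl
  ... | true = ⊥-elim (none (w , Pw , Qw))

∅ : ∀ {n} → Fin n → Bool
∅ _ = false

count : ∀ {n} → (Fin n → Bool) → ℕ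
count {zero} P = 0
count {suc n} P = if P zero then suc (count (P ∘ suc)) else count (P ∘ suc)

count-tail : ∀ {n} (P : Fin (suc n) → Bool) → count (P ∘ suc) ≤ count P
count-tail P with P zero
... | true = n≤1+n _
... | false = ≤-refl

count-< : ∀ {n} {P : Fin n → Bool} x → P x ≡ false → count P < n
count-< {P = P} zero P0 rewrite P0 = s≤s (count-≤ (P ∘ suc))
  where
  count-≤ : ∀ {n} (P : Fin n → Bool) → count P ≤ n
  count-≤ {zero} P = z≤n
  count-≤ {suc n} P with P zero
  ... | true = s≤s (count-≤ (P ∘ suc))
  ... | false = m≤n⇒m≤1+n (count-≤ (P ∘ suc))
count-< {P = P} (suc x) Px with P zero
... | true = s≤s (count-< x Px)
... | false = m≤n⇒m≤1+n (count-< x Px)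

count-mono : ∀ {n} {P Q : Fin n → Bool} → P ⊆ Q → count P ≤ count Q
count-mono {zero} _ = z≤n
count-mono {suc n} {P} {Q} P⊆Q with P zero in P0 | Q zero in Q0
... | true | true = s≤s (count-mono (P⊆Q ∘ suc))
... | false | true = m≤n⇒m≤1+n (count-mono (P⊆Q ∘ suc))
... | false | false = count-mono (P⊆Q ∘ suc)
... | true | false with () ← trans (sym (P⊆Q zero P0)) Q0

count-insert-≤ : ∀ {n} x (P : Fin n → Bool) → count (insert x P) ≤ suc (count P)
count-insert-≤ zero P = s≤s (count-tail P)
count-insert-≤ (suc x) P with P zero
... | true = s≤s (count-insert-≤ x (P ∘ suc))
... | false = count-insert-≤ x (P ∘ suc)

count-insert-≥ : ∀ {n} {x} {P : Fin n → Bool} → P x ≡ false → suc (count P) ≤ count (insert x P)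
count-insert-≥ {x = zero} {P} P0 rewrite P0 = ≤-refl
count-insert-≥ {x = suc x} {P} Px with P zero
... | true = s≤s (count-insert-≥ {P = P ∘ suc} Px)
... | false = count-insert-≥ {P = P ∘ suc} Px

count-∅ : ∀ {n} → count {n} ∅ ≡ 0
count-∅ {zero} = refl
count-∅ {suc n} = count-∅ {n}

third-element : ∀ {n} {P : Fin n → Bool} → 3 ≤ count P → ∀ p q → ∃ λ c → P c ≡ true × c ≢ p × c ≢ q
third-element {n} {P} 3≤|P| p q with any? (λ c → (P c Bool.≟ true) ×-dec ¬? (c ≟ᶠ p) ×-dec ¬? (c ≟ᶠ q))
... | yes found = found
... | no none = ⊥-elim (<-irrefl refl (≤-trans 3≤|P| (≤-trans (count-mono P⊆pq) |pq|≤2)))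
  where
  P⊆pq : P ⊆ insert p (insert q ∅)
  P⊆pq c Pc with c ≟ᶠ p | c ≟ᶠ q
  ... | yes _ | _ = refl
  ... | no _ | yes _ = refl
  ... | no c≢p | no c≢q = ⊥-elim (none (c , Pc , c≢p , c≢q))
  |pq|≤2 : count (insert p (insert q ∅)) ≤ 2
  |pq|≤2 = ≤-trans (count-insert-≤ p _) (s≤s (≤-trans (count-insert-≤ q ∅) (s≤s (≤-reflexive (count-∅ {n})))))

record Enumeration {n} (P : Fin n → Bool) (m : ℕ) : Set where
  field
    elem : Fin m → Fin n
    elem-injective : ∀ {i j} → elem i ≡ elem j → i ≡ j
    elem-∈ : ∀ i → P (elem i) ≡ true
    elem-surjective : ∀ {x} → P x ≡ true → ∃ λ i → elem i ≡ x

enumerate : ∀ {n} (P : Fin n → Bool) → Enumeration P (count P)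
enumerate {zero} P = record
  { elem = λ () ; elem-injective = λ {i} → ⊥-elim (¬Fin0 i) ; elem-∈ = λ () ; elem-surjective = λ {x} → ⊥-elim (¬Fin0 x) }
  where
  ¬Fin0 : Fin 0 → ⊥
  ¬Fin0 ()
enumerate {suc n} P with P zero in P0
... | true = record
  { elem = elem′ ; elem-injective = injective′ ; elem-∈ = ∈′ ; elem-surjective = surjective′ }
  where
  open Enumeration (enumerate (P ∘ suc))
  elem′ : Fin (suc (count (P ∘ suc))) → Fin (suc n)
  elem′ zero = zero
  elem′ (suc i) = suc (elem i)
  injective′ : ∀ {i j} → elem′ i ≡ elem′ j → i ≡ j
  injective′ {zero} {zero} _ = refl
  injective′ {suc i} {suc j} eq = cong suc (elem-injective (suc-injective eq))
  ∈′ : ∀ i → P (elem′ i) ≡ true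
  ∈′ zero = P0
  ∈′ (suc i) = elem-∈ i
  surjective′ : ∀ {x} → P x ≡ true → ∃ λ i → elem′ i ≡ x
  surjective′ {zero} _ = zero , refl
  surjective′ {suc x} Px = let i , eq = elem-surjective Px in suc i , cong suc eq
... | false = record
  { elem = suc ∘ elem ; elem-injective = elem-injective ∘ suc-injective ; elem-∈ = elem-∈ ; elem-surjective = surjective′ }
  where
  open Enumeration (enumerate (P ∘ suc))
  surjective′ : ∀ {x} → P x ≡ true → ∃ λ i → suc (elem i) ≡ x
  surjective′ {zero} P0′ with () ← trans (sym P0) P0′
  surjective′ {suc x} Px = let i , eq = elem-surjective Px in i , cong suc eq

-- Induced subgraphs from adjacency tables

module Adjacency {n} (G : Graph n) where

  infix 4 _~_ _≁_
  _~_ _≁_ : Fin n → Fin n → Set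
  u ~ w = adj G u w ≡ true
  u ≁ w = adj G u w ≡ false

  sym-adj : ∀ {u w b} → adj G u w ≡ b → adj G w u ≡ b
  sym-adj {u} {w} uw = trans (adj-sym G w u) uw

  ~⇒¬≁ : ∀ {u w} → u ~ w → ¬ u ≁ w
  ~⇒¬≁ u~w u≁w with () ← trans (sym u~w) u≁w

  ~≁⇒≢ : ∀ {t u w} → t ~ u → t ≁ w → u ≢ w
  ~≁⇒≢ t~u t≁w refl = ~⇒¬≁ t~u t≁w

  ~-intro : ∀ {u w} → ¬ u ≁ w → u ~ w
  ~-intro = Bool.¬-not

  ≁-intro : ∀ {u w} → ¬ u ~ w → u ≁ w
  ≁-intro = Bool.¬-not

  ~⇒≢ : ∀ {u w} → u ~ w → u ≢ w
  ~⇒≢ {u} u~u refl = ~⇒¬≁ u~u (adj-irrefl G u)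

pairs : ∀ k → List (Fin k × Fin k)
pairs zero = []
pairs (suc k) = map (zero ,_) (map suc (allFin k)) ++ map (Product.map suc suc) (pairs k)

∈-pairs : ∀ {k} {i j : Fin k} → i <ᶠ j → (i , j) ∈ pairs k
∈-pairs {i = zero} {suc j} _ = ∈-++⁺ˡ (∈-map⁺ (zero ,_) (∈-map⁺ suc (∈-allFin j)))
∈-pairs {suc k} {suc i} {suc j} (s≤s i<j) = ∈-++⁺ʳ _ (∈-map⁺ (Product.map suc suc) (∈-pairs i<j))

Twins : ∀ {k} → Graph k → Fin k → Fin k → Set
Twins H i j = ∀ t → adj H i t ≡ adj H j t

twins? : ∀ {k} (H : Graph k) i j → Dec (Twins H i j)
twins? H i j = all? (λ t → adj H i t Bool.≟ adj H j t)

TwinFree : ∀ {k} → Graph k → Set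
TwinFree H = ∀ i j → Twins H i j → i ≡ j

P5-twinFree : TwinFree P5
P5-twinFree = toWitness {a? = all? (λ i → all? (λ j → twins? P5 i j →-dec i ≟ᶠ j))} _

Bull-twinFree : TwinFree Bull
Bull-twinFree = toWitness {a? = all? (λ i → all? (λ j → twins? Bull i j →-dec i ≟ᶠ j))} _

private
  d₂ d₃ : Fin 4
  d₂ = suc (suc zero)
  d₃ = suc (suc (suc zero))

-- The two non-adjacent vertices of the diamond are twins, so a table alone
-- does not force an embedding to separate them.
Diamond-twins : ∀ i j → Twins Diamond i j → i ≢ j → i ≡ d₂ × j ≡ d₃ ⊎ i ≡ d₃ × j ≡ d₂
Diamond-twins = toWitness {a? = all? (λ i → all? (λ j → twins? Diamond i j →-dec (¬? (i ≟ᶠ j) →-dec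
  ((i ≟ᶠ d₂ ×-dec j ≟ᶠ d₃) ⊎-dec (i ≟ᶠ d₃ ×-dec j ≟ᶠ d₂)))))} _

module _ {n} (G : Graph n) where

  -- One entry per pair i < j, in lexicographic order; symmetry and
  -- irreflexivity supply the rest of the adjacency matrix.
  Table : ∀ {k} → Graph k → Vec (Fin n) k → Set
  Table {k} H vs = All (uncurry λ i j → adj G (lookup vs i) (lookup vs j) ≡ adj H i j) (pairs k)

  table-agrees : ∀ {k} (H : Graph k) vs → Table H vs → ∀ i j → adj G (lookup vs i) (lookup vs j) ≡ adj H i j
  table-agrees H vs table i j with <-cmp i j
  ... | tri< i<j _ _ = All.lookup table (∈-pairs i<j)
  ... | tri≈ _ refl _ = trans (adj-irrefl G (lookup vs i)) (sym (adj-irrefl H i))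
  ... | tri> _ _ j<i = trans (adj-sym G _ _) (trans (All.lookup table (∈-pairs j<i)) (adj-sym H j i))

  table⇒≲ : ∀ {k} (H : Graph k) vs → Table H vs →
    (∀ i j → Twins H i j → i ≢ j → lookup vs i ≢ lookup vs j) → H ≲ G
  table⇒≲ H vs table separated = lookup vs , injective , agrees
    where
    agrees = table-agrees H vs table
    injective : ∀ {i j} → lookup vs i ≡ lookup vs j → i ≡ j
    injective {i} {j} eq with i ≟ᶠ j
    ... | yes i≡j = i≡j
    ... | no i≢j = ⊥-elim (separated i j twins i≢j eq)
      where
      twins : Twins H i j
      twins t = trans (sym (agrees i t)) (trans (cong (λ v → adj G v (lookup vs t)) eq) (agrees j t))

  twinFree-table⇒≲ : ∀ {k} (H : Graph k) → TwinFree H → ∀ vs → Table H vs → H ≲ G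
  twinFree-table⇒≲ H twinFree vs table = table⇒≲ H vs table λ i j tw i≢j _ → i≢j (twinFree i j tw)

  P5≲ : ∀ vs → Table P5 vs → P5 ≲ G
  P5≲ = twinFree-table⇒≲ P5 P5-twinFree

  Bull≲ : ∀ vs → Table Bull vs → Bull ≲ G
  Bull≲ = twinFree-table⇒≲ Bull Bull-twinFree

  Diamond≲ : ∀ vs → Table Diamond vs → lookup vs d₂ ≢ lookup vs d₃ → Diamond ≲ G
  Diamond≲ vs table v₂≢v₃ = table⇒≲ Diamond vs table separated
    where
    separated : ∀ i j → Twins Diamond i j → i ≢ j → lookup vs i ≢ lookup vs j
    separated i j tw i≢j with Diamond-twins i j tw i≢j
    ... | inj₁ (refl , refl) = v₂≢v₃
    ... | inj₂ (refl , refl) = ≢-sym v₂≢v₃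

-- Cliques, induced subgraphs and colourings

module _ {n} (G : Graph n) where
  open Adjacency G

  degree : Fin n → ℕ
  degree x = count (adj G x)

  CliqueSet : (Fin n → Bool) → Set
  CliqueSet P = ∀ {p q} → P p ≡ true → P q ≡ true → p ≢ q → p ~ q

  clique-of-size : ∀ {P s} → CliqueSet P → s ≤ count P → HasClique G s
  clique-of-size {P} {s} clique s≤|P| = vertex , injective , λ i j i≢j → clique (elem-∈ _) (elem-∈ _) (i≢j ∘ injective)
    where
    open Enumeration (enumerate P)
    vertex : Fin s → Fin n
    vertex i = elem (inject≤ i s≤|P|)
    injective : ∀ {i j} → vertex i ≡ vertex j → i ≡ j
    injective eq = inject≤-injective s≤|P| s≤|P| _ _ (elem-injective eq)

  clique-≤ : ∀ {s t} → HasClique G s → t ≤ s → HasClique G t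
  clique-≤ (f , injective , clique) t≤s =
    (λ i → f (inject≤ i t≤s)) , inject≤-injective t≤s t≤s _ _ ∘ injective ,
    λ i j i≢j → clique _ _ (i≢j ∘ inject≤-injective t≤s t≤s _ _)

  insert-clique : ∀ {P x} → CliqueSet P → (∀ {q} → P q ≡ true → x ~ q) → CliqueSet (insert x P)
  insert-clique {P} {x} clique x~P {p} {q} p∈ q∈ p≢q with insert-cases {P = P} {x} {p} p∈ | insert-cases {P = P} {x} {q} q∈
  ... | inj₁ refl | inj₁ refl = ⊥-elim (p≢q refl)
  ... | inj₁ refl | inj₂ Pq = x~P Pq
  ... | inj₂ Pp | inj₁ refl = sym-adj (x~P Pp)
  ... | inj₂ Pp | inj₂ Pq = clique Pp Pq p≢q

  clique-or-non-edge : ∀ P → CliqueSet P ⊎ ∃₂ λ x y → P x ≡ true × P y ≡ true × x ≢ y × x ≁ y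
  clique-or-non-edge P with any? (λ x → any? (λ y →
    (P x Bool.≟ true) ×-dec (P y Bool.≟ true) ×-dec ¬? (x ≟ᶠ y) ×-dec (adj G x y Bool.≟ false)))
  ... | yes (x , y , non-edge) = inj₂ (x , y , non-edge)
  ... | no none = inj₁ clique
    where
    clique : CliqueSet P
    clique {p} {q} Pp Pq p≢q with adj G p q in pq
    ... | true = refl
    ... | false = ⊥-elim (none (p , q , Pp , Pq , p≢q , pq))

  DominatedBy : Fin n → Fin n → Set
  DominatedBy x u = x ≢ u × adj G x ⊆ adj G u

  dominatedBy? : Dec (∃₂ DominatedBy)
  dominatedBy? = any? (λ x → any? (λ u → ¬? (x ≟ᶠ u) ×-dec
    all? (λ w → (adj G x w Bool.≟ true) →-dec (adj G u w Bool.≟ true))))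

infix 25 _[_]
_[_] : ∀ {n} (G : Graph n) (P : Fin n → Bool) → Graph (count P)
G [ P ] = record
  { adj = λ i j → adj G (elem i) (elem j)
  ; adj-sym = λ i j → adj-sym G (elem i) (elem j)
  ; adj-irrefl = λ i → adj-irrefl G (elem i)
  }
  where open Enumeration (enumerate P)

module _ {n} (G : Graph n) (P : Fin n → Bool) where
  open Enumeration (enumerate P)

  ≲-[] : ∀ {k} {H : Graph k} → H ≲ G [ P ] → H ≲ G
  ≲-[] (f , injective , agrees) = elem ∘ f , injective ∘ elem-injective , agrees

  clique-[] : ∀ {s} → HasClique (G [ P ]) s → HasClique G s
  clique-[] (f , injective , clique) = elem ∘ f , injective ∘ elem-injective , clique

  free-[] : ∀ {k} (H : Graph k) → G Free H → G [ P ] Free H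
  free-[] H G-free embedding = G-free (≲-[] {H = H} embedding)

missing-value : ∀ {m c} → m < c → (g : Fin m → Fin c) → ∃ λ v → ∀ i → g i ≢ v
missing-value {m} {c} m<c g with any? (λ v → all? (λ i → ¬? (g i ≟ᶠ v)))
... | yes found = found
... | no none = ⊥-elim (<-irrefl refl (≤-trans m<c (injective⇒≤ preimage-injective)))
  where
  preimage : ∀ v → ∃ λ i → g i ≡ v
  preimage v with any? (λ i → g i ≟ᶠ v)
  ... | yes hit = hit
  ... | no miss = ⊥-elim (none (v , λ i gi≡v → miss (i , gi≡v)))
  preimage-injective : ∀ {v w} → proj₁ (preimage v) ≡ proj₁ (preimage w) → v ≡ w
  preimage-injective {v} {w} eq = trans (sym (proj₂ (preimage v))) (trans (cong g eq) (proj₂ (preimage w)))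

-- i ↦ i + 1 modulo m + 1
rotate : ∀ {m} → Fin (suc m) → Fin (suc m)
rotate i with view i
... | ‵fromℕ = zero
... | ‵inject₁ j = suc j

rotate-injective : ∀ {m} {i j : Fin (suc m)} → rotate i ≡ rotate j → i ≡ j
rotate-injective {i = i} {j} eq with view i | view j
... | ‵fromℕ | ‵fromℕ = refl
... | ‵inject₁ i′ | ‵inject₁ j′ = cong inject₁ (suc-injective eq)

rotate-≢ : ∀ {m} (i : Fin (suc (suc m))) → rotate i ≢ i
rotate-≢ i eq with view i
rotate-≢ _ () | ‵fromℕ
... | ‵inject₁ j = 1+n≢n (trans (cong toℕ eq) (toℕ-inject₁ j))

ColouringOn : ∀ {n} → Graph n → (Fin n → Bool) → ℕ → Set
ColouringOn {n} G P c = Σ (Fin n → Fin c) λ colour →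
  ∀ {u w} → P u ≡ true → P w ≡ true → adj G u w ≡ true → colour u ≢ colour w

colouringOn-[] : ∀ {n c} (G : Graph n) (P : Fin n → Bool) → Fin c → Colouring (G [ P ]) c → ColouringOn G P c
colouringOn-[] {n} {c} G P default (colour , proper) = colour′ , proper′
  where
  open Enumeration (enumerate P)
  colour′ : Fin n → Fin c
  colour′ x with P x Bool.≟ true
  ... | yes Px = colour (proj₁ (elem-surjective Px))
  ... | no _ = default
  proper′ : ∀ {u w} → P u ≡ true → P w ≡ true → adj G u w ≡ true → colour′ u ≢ colour′ w
  proper′ {u} {w} Pu Pw u~w with P u Bool.≟ true | P w Bool.≟ true
  ... | no ¬Pu | _ = ⊥-elim (¬Pu Pu)
  ... | yes _ | no ¬Pw = ⊥-elim (¬Pw Pw)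
  ... | yes Pu′ | yes Pw′ with elem-surjective Pu′ | elem-surjective Pw′
  ... | i , refl | j , refl = proper i j u~w

allBut : ∀ {n} → Fin n → Fin n → Bool
allBut x u = not (does (u ≟ᶠ x))

allBut-∈ : ∀ {n} {x u : Fin n} → u ≢ x → allBut x u ≡ true
allBut-∈ {x = x} {u} u≢x rewrite dec-false (u ≟ᶠ x) u≢x = refl

allBut-self : ∀ {n} (x : Fin n) → allBut x x ≡ false
allBut-self x rewrite dec-true (x ≟ᶠ x) refl = refl

module _ {n} (G : Graph n) {c : ℕ} where
  open Adjacency G

  extend-vertex : ∀ {x} (colouring : ColouringOn G (allBut x) c) (new : Fin c) →
    (∀ {w} → x ~ w → proj₁ colouring w ≢ new) → Colouring G c
  extend-vertex {x} (colour , proper) new avoids = colour′ , proper′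
    where
    colour′ : Fin n → Fin c
    colour′ u = if does (u ≟ᶠ x) then new else colour u
    proper′ : ∀ u w → u ~ w → colour′ u ≢ colour′ w
    proper′ u w u~w with u ≟ᶠ x | w ≟ᶠ x
    ... | yes refl | yes refl = λ _ → ~⇒≢ u~w refl
    ... | yes refl | no _ = avoids u~w ∘ sym
    ... | no _ | yes refl = avoids (sym-adj u~w)
    ... | no u≢x | no w≢x = proper (allBut-∈ u≢x) (allBut-∈ w≢x) u~w

  extend-low-degree : ∀ {x} → degree G x < c → ColouringOn G (allBut x) c → Colouring G c
  extend-low-degree {x} deg<c colouring@(colour , _) = extend-vertex colouring new avoids
    where
    open Enumeration (enumerate (adj G x))
    missing = missing-value deg<c (colour ∘ elem)
    new = proj₁ missing
    avoids : ∀ {w} → x ~ w → colour w ≢ new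
    avoids x~w with elem-surjective x~w
    ... | i , refl = proj₂ missing i

  extend-dominated : ∀ {x u} → DominatedBy G x u → ColouringOn G (allBut x) c → Colouring G c
  extend-dominated {x} {u} (x≢u , N[x]⊆N[u]) colouring@(colour , proper) =
    extend-vertex colouring (colour u) avoids
    where
    avoids : ∀ {w} → x ~ w → colour w ≢ colour u
    avoids {w} x~w = proper (allBut-∈ (≢-sym (~⇒≢ x~w))) (allBut-∈ (≢-sym x≢u)) (sym-adj (N[x]⊆N[u] w x~w))

record MatchedIntoClique {n} (G : Graph n) : Set where
  open Adjacency G
  field
    member : Fin n → Bool
    some-member : Fin n
    some-member-∈ : member some-member ≡ true
    partner : Fin n → Fin n
    partner-∉ : ∀ {a} → member a ≡ true → member (partner a) ≡ false
    partner-unique : ∀ {a u} → member a ≡ true → member u ≡ false → a ~ u → u ≡ partner a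
    partners-adjacent : ∀ {a b} → member a ≡ true → member b ≡ true → a ≢ b → partner a ~ partner b

  outside : Fin n → Bool
  outside = not ∘ member

-- Partners of distinct members are adjacent, so the rotated colours on K are
-- distinct; each differs from the colour of the partner, the only neighbour outside K.
extend-matched : ∀ {n c} {G : Graph n} → 2 ≤ c → (M : MatchedIntoClique G) →
  ColouringOn G (MatchedIntoClique.outside M) c → Colouring G c
extend-matched {n} {suc (suc c)} {G} (s≤s (s≤s z≤n)) M (colour , proper) = colour′ , proper′
  where
  open Adjacency G
  open MatchedIntoClique M
  outside-∈ : ∀ {u} → member u ≡ false → outside u ≡ true
  outside-∈ u∉ rewrite u∉ = refl
  colour′ : Fin n → Fin (suc (suc c))
  colour′ u = if member u then rotate (colour (partner u)) else colour u
  proper′ : ∀ u w → u ~ w → colour′ u ≢ colour′ w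
  proper′ u w u~w with member u in u∈ | member w in w∈
  ... | true | true = proper (outside-∈ (partner-∉ u∈)) (outside-∈ (partner-∉ w∈)) (partners-adjacent u∈ w∈ (~⇒≢ u~w))
                      ∘ rotate-injective
  ... | true | false with refl ← partner-unique u∈ w∈ u~w = rotate-≢ (colour w)
  ... | false | true with refl ← partner-unique w∈ u∈ (sym-adj u~w) = rotate-≢ (colour u) ∘ sym
  ... | false | false = proper (outside-∈ u∈) (outside-∈ w∈) u~w

-- Irreducible (P5, bull, diamond)-free graphs

module Structure {n} (G : Graph n) (p5-free : G Free P5) (bull-free : G Free Bull) (diamond-free : G Free Diamond) where
  open Adjacency G

  nbhd-transitive : ∀ {a p q r} → a ~ p → a ~ q → a ~ r → p ~ q → q ~ r → p ≢ r → p ~ r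
  nbhd-transitive {a} {p} {q} {r} a~p a~q a~r p~q q~r p≢r = ~-intro λ p≁r →
    diamond-free (Diamond≲ G (a ∷ q ∷ p ∷ r ∷ []) (a~q ∷ a~p ∷ a~r ∷ sym-adj p~q ∷ q~r ∷ p≁r ∷ []) p≢r)

  nbhd-≁ : ∀ {a p q r} → a ~ p → a ~ q → a ~ r → p ~ q → p ≁ r → p ≢ r → q ≁ r
  nbhd-≁ a~p a~q a~r p~q p≁r p≢r = ≁-intro λ q~r → ~⇒¬≁ (nbhd-transitive a~p a~q a~r p~q q~r p≢r) p≁r

  record InducedC5 : Set where
    field
      c₀ c₁ c₂ c₃ c₄ : Fin n
      c₀~c₁ : c₀ ~ c₁
      c₁~c₂ : c₁ ~ c₂
      c₂~c₃ : c₂ ~ c₃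
      c₃~c₄ : c₃ ~ c₄
      c₄~c₀ : c₄ ~ c₀
      c₀≁c₂ : c₀ ≁ c₂
      c₀≁c₃ : c₀ ≁ c₃
      c₁≁c₃ : c₁ ≁ c₃
      c₁≁c₄ : c₁ ≁ c₄
      c₂≁c₄ : c₂ ≁ c₄

  rotateC5 : InducedC5 → InducedC5
  rotateC5 C = record
    { c₀ = c₁ ; c₁ = c₂ ; c₂ = c₃ ; c₃ = c₄ ; c₄ = c₀
    ; c₀~c₁ = c₁~c₂ ; c₁~c₂ = c₂~c₃ ; c₂~c₃ = c₃~c₄ ; c₃~c₄ = c₄~c₀ ; c₄~c₀ = c₀~c₁
    ; c₀≁c₂ = c₁≁c₃ ; c₀≁c₃ = c₁≁c₄ ; c₁≁c₃ = c₂≁c₄ ; c₁≁c₄ = sym-adj c₀≁c₂ ; c₂≁c₄ = sym-adj c₀≁c₃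
    }
    where open InducedC5 C

  reflectC5 : InducedC5 → InducedC5
  reflectC5 C = record
    { c₀ = c₀ ; c₁ = c₄ ; c₂ = c₃ ; c₃ = c₂ ; c₄ = c₁
    ; c₀~c₁ = sym-adj c₄~c₀ ; c₁~c₂ = sym-adj c₃~c₄ ; c₂~c₃ = sym-adj c₂~c₃ ; c₃~c₄ = sym-adj c₁~c₂ ; c₄~c₀ = sym-adj c₀~c₁
    ; c₀≁c₂ = c₀≁c₃ ; c₀≁c₃ = c₀≁c₂ ; c₁≁c₃ = sym-adj c₂≁c₄ ; c₁≁c₄ = sym-adj c₁≁c₄ ; c₂≁c₄ = sym-adj c₁≁c₃
    }
    where open InducedC5 C

  module _ (C : InducedC5) where
    open InducedC5 C

    c5-neighbour : ∀ {z} → z ~ c₀ → z ~ c₂ × z ≁ c₁ × z ≁ c₃ × z ≁ c₄ ⊎ z ~ c₃ × z ≁ c₁ × z ≁ c₂ × z ≁ c₄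
    c5-neighbour {z} z~c₀ with adj G z c₁ in z?c₁ | adj G z c₄ in z?c₄
    ... | true | true = ⊥-elim (diamond-free (Diamond≲ G (c₀ ∷ z ∷ c₁ ∷ c₄ ∷ [])
          (sym-adj z~c₀ ∷ c₀~c₁ ∷ sym-adj c₄~c₀ ∷ z?c₁ ∷ z?c₄ ∷ c₁≁c₄ ∷ []) (~≁⇒≢ (sym-adj c₁~c₂) c₂≁c₄)))
    ... | true | false with adj G z c₂ in z?c₂
    ...   | true = ⊥-elim (diamond-free (Diamond≲ G (c₁ ∷ z ∷ c₀ ∷ c₂ ∷ [])
            (sym-adj z?c₁ ∷ sym-adj c₀~c₁ ∷ c₁~c₂ ∷ z~c₀ ∷ z?c₂ ∷ c₀≁c₂ ∷ []) (~≁⇒≢ c₄~c₀ (sym-adj c₂≁c₄))))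
    ...   | false = ⊥-elim (bull-free (Bull≲ G (c₀ ∷ c₁ ∷ z ∷ c₄ ∷ c₂ ∷ [])
            (c₀~c₁ ∷ sym-adj z~c₀ ∷ sym-adj c₄~c₀ ∷ c₀≁c₂ ∷ sym-adj z?c₁ ∷ c₁≁c₄ ∷ c₁~c₂ ∷ z?c₄ ∷ z?c₂ ∷ sym-adj c₂≁c₄ ∷ [])))
    c5-neighbour {z} z~c₀ | false | true with adj G z c₃ in z?c₃
    ...   | true = ⊥-elim (diamond-free (Diamond≲ G (c₄ ∷ z ∷ c₀ ∷ c₃ ∷ [])
            (sym-adj z?c₄ ∷ c₄~c₀ ∷ sym-adj c₃~c₄ ∷ z~c₀ ∷ z?c₃ ∷ c₀≁c₃ ∷ []) (~≁⇒≢ (sym-adj c₀~c₁) c₁≁c₃)))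
    ...   | false = ⊥-elim (bull-free (Bull≲ G (c₀ ∷ c₄ ∷ z ∷ c₁ ∷ c₃ ∷ [])
            (sym-adj c₄~c₀ ∷ sym-adj z~c₀ ∷ c₀~c₁ ∷ c₀≁c₃ ∷ sym-adj z?c₄ ∷ sym-adj c₁≁c₄ ∷ sym-adj c₃~c₄ ∷ z?c₁ ∷ z?c₃ ∷ c₁≁c₃ ∷ [])))
    c5-neighbour {z} z~c₀ | false | false with adj G z c₂ in z?c₂ | adj G z c₃ in z?c₃
    ... | true | true = ⊥-elim (bull-free (Bull≲ G (c₂ ∷ c₃ ∷ z ∷ c₁ ∷ c₄ ∷ [])
          (c₂~c₃ ∷ sym-adj z?c₂ ∷ sym-adj c₁~c₂ ∷ c₂≁c₄ ∷ sym-adj z?c₃ ∷ sym-adj c₁≁c₃ ∷ c₃~c₄ ∷ z?c₁ ∷ z?c₄ ∷ c₁≁c₄ ∷ [])))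
    ... | true | false = inj₁ (refl , refl , refl , refl)
    ... | false | true = inj₂ (refl , refl , refl , refl)
    ... | false | false = ⊥-elim (p5-free (P5≲ G (z ∷ c₀ ∷ c₁ ∷ c₂ ∷ c₃ ∷ [])
          (z~c₀ ∷ z?c₁ ∷ z?c₂ ∷ z?c₃ ∷ c₀~c₁ ∷ c₀≁c₂ ∷ c₀≁c₃ ∷ c₁~c₂ ∷ c₁≁c₃ ∷ c₂~c₃ ∷ [])))

  module _ (C : InducedC5) where
    open InducedC5 C

    c5-clone-dominates : ∀ {z} → z ≢ c₁ → z ~ c₀ → z ~ c₂ → z ≁ c₁ → z ≁ c₃ → z ≁ c₄ → DominatedBy G c₁ z
    c5-clone-dominates {z} z≢c₁ z~c₀ z~c₂ z≁c₁ z≁c₃ z≁c₄ = ≢-sym z≢c₁ , N[c₁]⊆N[z]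
      where
      N[c₁]⊆N[z] : adj G c₁ ⊆ adj G z
      N[c₁]⊆N[z] w c₁~w = ~-intro λ z≁w → case c5-neighbour (rotateC5 C) (sym-adj c₁~w) of λ where
        (inj₁ (w~c₃ , w≁c₂ , w≁c₄ , w≁c₀)) → p5-free (P5≲ G (w ∷ c₃ ∷ c₂ ∷ z ∷ c₀ ∷ [])
          (w~c₃ ∷ w≁c₂ ∷ sym-adj z≁w ∷ w≁c₀ ∷ sym-adj c₂~c₃ ∷ sym-adj z≁c₃ ∷ sym-adj c₀≁c₃ ∷ sym-adj z~c₂ ∷ sym-adj c₀≁c₂ ∷ z~c₀ ∷ []))
        (inj₂ (w~c₄ , w≁c₂ , w≁c₃ , w≁c₀)) → p5-free (P5≲ G (z ∷ c₂ ∷ c₁ ∷ w ∷ c₄ ∷ [])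
          (z~c₂ ∷ z≁c₁ ∷ z≁w ∷ z≁c₄ ∷ sym-adj c₁~c₂ ∷ sym-adj w≁c₂ ∷ c₂≁c₄ ∷ c₁~w ∷ c₁≁c₄ ∷ w~c₄ ∷ []))

  module Irreducible {k} (3≤k : 3 ≤ k) (ω≤k : ¬ HasClique G (suc k))
    (δ≥k : ∀ x → k ≤ degree G x) (undominated : ∀ x u → ¬ DominatedBy G x u) where

    ¬large-clique : ∀ {P} → CliqueSet G P → k < count P → ⊥
    ¬large-clique clique k<|P| = ω≤k (clique-of-size G clique k<|P|)

    ¬nbhd-clique : ∀ x → ¬ CliqueSet G (adj G x)
    ¬nbhd-clique x clique =
      ¬large-clique (insert-clique G clique id) (≤-trans (s≤s (δ≥k x)) (count-insert-≥ {P = adj G x} (adj-irrefl G x)))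

    private-neighbour : ∀ {x y} → x ≢ y → ∃ λ w → x ~ w × y ≁ w
    private-neighbour x≢y = ⊈-witness λ N[x]⊆N[y] → undominated _ _ (x≢y , N[x]⊆N[y])

    module _ (C : InducedC5) where
      open InducedC5 C

      ¬induced-C5 : ⊥
      ¬induced-C5 with third-element (≤-trans 3≤k (δ≥k c₀)) c₁ c₄
      ... | z , c₀~z , z≢c₁ , z≢c₄ with c5-neighbour C (sym-adj c₀~z)
      ... | inj₁ (z~c₂ , z≁c₁ , z≁c₃ , z≁c₄) =
        undominated _ _ (c5-clone-dominates C z≢c₁ (sym-adj c₀~z) z~c₂ z≁c₁ z≁c₃ z≁c₄)
      ... | inj₂ (z~c₃ , z≁c₁ , z≁c₂ , z≁c₄) =
        undominated _ _ (c5-clone-dominates (reflectC5 C) z≢c₄ (sym-adj c₀~z) z~c₃ z≁c₄ z≁c₂ z≁c₁)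

    IsolatedIn : Fin n → Fin n → Set
    IsolatedIn a x = ∀ w → a ~ w → x ≁ w

    isolated-≁ : ∀ {a x w} → IsolatedIn a x → x ~ w → a ≁ w
    isolated-≁ iso x~w = ≁-intro λ a~w → ~⇒¬≁ x~w (iso _ a~w)

    ¬two-isolated : ∀ {a x y} → a ~ x → a ~ y → x ≢ y → IsolatedIn a x → IsolatedIn a y → ⊥
    ¬two-isolated {a} {x} {y} a~x a~y x≢y iso-x iso-y = closes-C5 (private-neighbour x≢y) (private-neighbour (≢-sym x≢y))
      where
      closes-C5 : (∃ λ x′ → x ~ x′ × y ≁ x′) → (∃ λ y′ → y ~ y′ × x ≁ y′) → ⊥
      closes-C5 (x′ , x~x′ , y≁x′) (y′ , y~y′ , x≁y′) = ¬induced-C5 record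
        { c₀ = a ; c₁ = x ; c₂ = x′ ; c₃ = y′ ; c₄ = y
        ; c₀~c₁ = a~x ; c₁~c₂ = x~x′ ; c₂~c₃ = x′~y′ ; c₃~c₄ = sym-adj y~y′ ; c₄~c₀ = sym-adj a~y
        ; c₀≁c₂ = a≁x′ ; c₀≁c₃ = a≁y′ ; c₁≁c₃ = x≁y′ ; c₁≁c₄ = x≁y ; c₂≁c₄ = sym-adj y≁x′
        }
        where
        a≁x′ = isolated-≁ iso-x x~x′
        a≁y′ = isolated-≁ iso-y y~y′
        x≁y = iso-x y a~y
        x′~y′ : x′ ~ y′
        x′~y′ = ~-intro λ x′≁y′ → p5-free (P5≲ G (x′ ∷ x ∷ a ∷ y ∷ y′ ∷ [])
          (sym-adj x~x′ ∷ sym-adj a≁x′ ∷ sym-adj y≁x′ ∷ x′≁y′ ∷ sym-adj a~x ∷ x≁y ∷ x≁y′ ∷ a~y ∷ a≁y′ ∷ y~y′ ∷ []))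

    ¬two-components : ∀ {a x x′ y y′} → a ~ x → a ~ x′ → a ~ y → a ~ y′ → x ~ x′ → y ~ y′ → x ≁ y → x ≢ y → ⊥
    ¬two-components {a} {x} {x′} {y} {y′} a~x a~x′ a~y a~y′ x~x′ y~y′ x≁y x≢y = ¬nbhd-clique x clique
      where
      x′≁y : x′ ≁ y
      x′≁y = nbhd-≁ a~x a~x′ a~y x~x′ x≁y x≢y
      x≁y′ : x ≁ y′
      x≁y′ = sym-adj (nbhd-≁ a~y a~y′ a~x y~y′ (sym-adj x≁y) (≢-sym x≢y))
      x′≁y′ : x′ ≁ y′
      x′≁y′ = nbhd-≁ a~x a~x′ a~y′ x~x′ x≁y′ (~≁⇒≢ y~y′ (sym-adj x≁y) ∘ sym)
      N[x]⊆N[a] : ∀ {w} → x ~ w → w ≢ a → a ~ w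
      N[x]⊆N[a] {w} x~w w≢a = ~-intro λ a≁w →
        diamond-free (Diamond≲ G (y ∷ y′ ∷ a ∷ w ∷ []) (y~y′ ∷ sym-adj a~y ∷ y~w a≁w ∷ sym-adj a~y′ ∷ y′~w a≁w ∷ a≁w ∷ []) (≢-sym w≢a))
        where
        x′≁w : a ≁ w → x′ ≁ w
        x′≁w a≁w = ≁-intro λ x′~w →
          diamond-free (Diamond≲ G (x ∷ x′ ∷ a ∷ w ∷ []) (x~x′ ∷ sym-adj a~x ∷ x~w ∷ sym-adj a~x′ ∷ x′~w ∷ a≁w ∷ []) (≢-sym w≢a))
        y~w : a ≁ w → y ~ w
        y~w a≁w = ~-intro λ y≁w → bull-free (Bull≲ G (a ∷ x ∷ x′ ∷ y ∷ w ∷ [])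
          (a~x ∷ a~x′ ∷ a~y ∷ a≁w ∷ x~x′ ∷ x≁y ∷ x~w ∷ x′≁y ∷ x′≁w a≁w ∷ y≁w ∷ []))
        y′~w : a ≁ w → y′ ~ w
        y′~w a≁w = ~-intro λ y′≁w → bull-free (Bull≲ G (a ∷ x ∷ x′ ∷ y′ ∷ w ∷ [])
          (a~x ∷ a~x′ ∷ a~y′ ∷ a≁w ∷ x~x′ ∷ x≁y′ ∷ x~w ∷ x′≁y′ ∷ x′≁w a≁w ∷ y′≁w ∷ []))
      clique : CliqueSet G (adj G x)
      clique {p} {q} x~p x~q p≢q with p ≟ᶠ a | q ≟ᶠ a
      ... | yes refl | yes refl = ⊥-elim (p≢q refl)
      ... | yes refl | no q≢a = N[x]⊆N[a] x~q q≢a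
      ... | no p≢a | yes refl = sym-adj (N[x]⊆N[a] x~p p≢a)
      ... | no p≢a | no q≢a = nbhd-transitive (N[x]⊆N[a] x~p p≢a) a~x (N[x]⊆N[a] x~q q≢a) (sym-adj x~p) x~q p≢q

    component-absorbs : ∀ {a x x′ y w} → a ~ x → a ~ x′ → x ~ x′ → a ~ y → IsolatedIn a y →
      a ~ w → w ≢ y → w ≢ x → x ~ w
    component-absorbs {a} {x} {x′} {y} {w} a~x a~x′ x~x′ a~y iso-y a~w w≢y w≢x = ~-intro λ x≁w →
      case disjoint-or-meet (adj G a) (adj G w) of λ where
        (inj₁ iso-w) → ¬two-isolated a~y a~w (≢-sym w≢y) iso-y iso-w
        (inj₂ (w′ , a~w′ , w~w′)) → ¬two-components a~x a~x′ a~w a~w′ x~x′ w~w′ x≁w (≢-sym w≢x)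

    rest-clique : ∀ {a x x′ y} → a ~ x → a ~ x′ → x ~ x′ → a ~ y → IsolatedIn a y →
      CliqueSet G (remove y (adj G a))
    rest-clique {a} {x} {x′} {y} a~x a~x′ x~x′ a~y iso-y = clique
      where
      x~ : ∀ {w} → a ~ w → w ≢ y → w ≢ x → x ~ w
      x~ = component-absorbs a~x a~x′ x~x′ a~y iso-y
      clique : CliqueSet G (remove y (adj G a))
      clique {p} {q} p∈ q∈ p≢q
        with remove⁻ {P = adj G a} {y} {p} p∈ | remove⁻ {P = adj G a} {y} {q} q∈ | p ≟ᶠ x | q ≟ᶠ x
      ... | _ | _ | yes refl | yes refl = ⊥-elim (p≢q refl)
      ... | _ | a~q , q≢y | yes refl | no q≢x = x~ a~q q≢y q≢x
      ... | a~p , p≢y | _ | no p≢x | yes refl = sym-adj (x~ a~p p≢y p≢x)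
      ... | a~p , p≢y | a~q , q≢y | no p≢x | no q≢x =
        nbhd-transitive a~p a~x a~q (sym-adj (x~ a~p p≢y p≢x)) (x~ a~q q≢y q≢x) p≢q

    record NbhdShape (a : Fin n) : Set where
      field
        lone : Fin n
        a~lone : a ~ lone
        lone-isolated : IsolatedIn a lone
        rest-is-clique : CliqueSet G (remove lone (adj G a))

    nbhd-shape : ∀ a → NbhdShape a
    nbhd-shape a with clique-or-non-edge G (adj G a)
    ... | inj₁ clique = ⊥-elim (¬nbhd-clique a clique)
    ... | inj₂ (x , y , a~x , a~y , x≢y , x≁y)
      with disjoint-or-meet (adj G a) (adj G x) | disjoint-or-meet (adj G a) (adj G y)
    ... | inj₁ iso-x | inj₁ iso-y = ⊥-elim (¬two-isolated a~x a~y x≢y iso-x iso-y)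
    ... | inj₂ (x′ , a~x′ , x~x′) | inj₂ (y′ , a~y′ , y~y′) = ⊥-elim (¬two-components a~x a~x′ a~y a~y′ x~x′ y~y′ x≁y x≢y)
    ... | inj₂ (x′ , a~x′ , x~x′) | inj₁ iso-y = record
      { lone = y ; a~lone = a~y ; lone-isolated = iso-y ; rest-is-clique = rest-clique a~x a~x′ x~x′ a~y iso-y }
    ... | inj₁ iso-x | inj₂ (y′ , a~y′ , y~y′) = record
      { lone = x ; a~lone = a~x ; lone-isolated = iso-x ; rest-is-clique = rest-clique a~y a~y′ y~y′ a~x iso-x }

    partner : Fin n → Fin n
    partner a = NbhdShape.lone (nbhd-shape a)

    a~partner : ∀ a → a ~ partner a
    a~partner a = NbhdShape.a~lone (nbhd-shape a)

    partner-isolated : ∀ a → IsolatedIn a (partner a)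
    partner-isolated a = NbhdShape.lone-isolated (nbhd-shape a)

    module MatchedAt (v : Fin n) where
      R K : Fin n → Bool
      R = remove (partner v) (adj G v)
      K = insert v R

      K-clique : CliqueSet G K
      K-clique = insert-clique G (NbhdShape.rest-is-clique (nbhd-shape v)) λ {q} q∈R → proj₁ (remove⁻ {P = adj G v} {partner v} {q} q∈R)

      k≤|K| : k ≤ count K
      k≤|K| = begin
        k                              ≤⟨ δ≥k v ⟩
        degree G v                     ≤⟨ count-mono (⊆-insert-remove {P = adj G v}) ⟩
        count (insert (partner v) R)   ≤⟨ count-insert-≤ (partner v) R ⟩
        suc (count R)                  ≤⟨ count-insert-≥ {P = R} (remove-∉ {P = adj G v} (adj-irrefl G v)) ⟩
        count K                        ∎
        where open ≤-Reasoning

      third : ∀ p q → ∃ λ c → K c ≡ true × c ≢ p × c ≢ q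
      third = third-element (≤-trans 3≤k k≤|K|)

      partner-∉ : ∀ {a} → K a ≡ true → K (partner a) ≡ false
      partner-∉ {a} a∈K = Bool.¬-not λ pa∈K →
        let c , c∈K , c≢a , c≢pa = third a (partner a)
        in ~⇒¬≁ (K-clique pa∈K c∈K (c≢pa ∘ sym)) (partner-isolated a c (K-clique a∈K c∈K (c≢a ∘ sym)))

      partner-unique : ∀ {a u} → K a ≡ true → K u ≡ false → a ~ u → u ≡ partner a
      partner-unique {a} {u} a∈K u∉K a~u with u ≟ᶠ partner a
      ... | yes u≡pa = u≡pa
      ... | no u≢pa = ⊥-elim (¬large-clique (insert-clique G K-clique u~K) (≤-trans (s≤s k≤|K|) (count-insert-≥ {P = K} u∉K)))
        where
        u~K : ∀ {q} → K q ≡ true → u ~ q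
        u~K {q} q∈K with q ≟ᶠ a
        ... | yes refl = sym-adj a~u
        ... | no q≢a = NbhdShape.rest-is-clique (nbhd-shape a)
          (remove⁺ {P = adj G a} a~u u≢pa) (remove⁺ {P = adj G a} (K-clique a∈K q∈K (q≢a ∘ sym)) (∈∉⇒≢ {P = K} q∈K (partner-∉ a∈K)))
          (∈∉⇒≢ {P = K} q∈K u∉K ∘ sym)

      partners-adjacent : ∀ {a b} → K a ≡ true → K b ≡ true → a ≢ b → partner a ~ partner b
      partners-adjacent {a} {b} a∈K b∈K a≢b = ~-intro λ pa≁pb →
        let c , c∈K , c≢a , c≢b = third a b
            a~b = K-clique a∈K b∈K a≢b
            a~c = K-clique a∈K c∈K (c≢a ∘ sym)
            b~c = K-clique b∈K c∈K (c≢b ∘ sym)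
        in bull-free (Bull≲ G (a ∷ b ∷ c ∷ partner a ∷ partner b ∷ [])
          (a~b ∷ a~c ∷ a~partner a ∷ sym-adj (partner-isolated b a (sym-adj a~b)) ∷ b~c ∷ sym-adj (partner-isolated a b a~b)
           ∷ a~partner b ∷ sym-adj (partner-isolated a c a~c) ∷ sym-adj (partner-isolated b c b~c) ∷ pa≁pb ∷ []))

    matched-clique : Fin n → MatchedIntoClique G
    matched-clique v = record
      { member = K ; some-member = v ; some-member-∈ = insert-∈ {P = R} v ; partner = partner
      ; partner-∉ = partner-∉ ; partner-unique = partner-unique ; partners-adjacent = partners-adjacent }
      where open MatchedAt v

colourable : ∀ {k} → 3 ≤ k → ∀ {n} (G : Graph n) →
  G Free P5 → G Free Bull → G Free Diamond → ¬ HasClique G (suc k) → Colouring G k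
colourable {k} 3≤k {n} = <-rec Goal step n
  where
  Goal : ℕ → Set
  Goal n = (G : Graph n) → G Free P5 → G Free Bull → G Free Diamond → ¬ HasClique G (suc k) → Colouring G k

  step : ∀ n → (∀ {m} → m < n → Goal m) → Goal n
  step zero _ _ _ _ _ _ = (λ ()) , λ ()
  step (suc n) colour-smaller G p5-free bull-free diamond-free ω≤k = colouring
    where
    colour-on : ∀ P x → P x ≡ false → ColouringOn G P k
    colour-on P x Px = colouringOn-[] G P (fromℕ< 3≤k) (colour-smaller (count-< {P = P} x Px) (G [ P ])
      (free-[] G P P5 p5-free) (free-[] G P Bull bull-free) (free-[] G P Diamond diamond-free) (ω≤k ∘ clique-[] G P))

    colour-all-but : ∀ x → ColouringOn G (allBut x) k
    colour-all-but x = colour-on (allBut x) x (allBut-self x)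

    colouring : Colouring G k
    colouring with any? (λ x → degree G x <? k) | dominatedBy? G
    ... | yes (x , deg<k) | _ = extend-low-degree G deg<k (colour-all-but x)
    ... | no _ | yes (x , u , dominated) = extend-dominated G dominated (colour-all-but x)
    ... | no ¬low-degree | no ¬dominated =
      extend-matched (≤-trans (n≤1+n 2) 3≤k) M (colour-on outside some-member (cong not some-member-∈))
      where
      open Structure G p5-free bull-free diamond-free
      M = Irreducible.matched-clique 3≤k ω≤k (λ x → ≮⇒≥ (¬low-degree ∘ (x ,_))) (λ x u → ¬dominated ∘ (x ,_) ∘ (u ,_)) zero
      open MatchedIntoClique M

corollary3p11 : ∀ {n} (G : Graph n) (w : ℕ) →
    G Free P5 → G Free Bull → G Free Diamond →
    IsCliqueNumber G w →
    χ≤ G (3 ⊔ w)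
corollary3p11 G w p5-free bull-free diamond-free (_ , ω<1+w) =
  colourable (m≤m⊔n 3 w) G p5-free bull-free diamond-free λ clique → ω<1+w (clique-≤ G clique (s≤s (m≤n⊔m 3 w)))
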